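{- Let $n$ be a positive integer and let $\langle a_1,\dots,a_k\rangle\in\mathcal{A}(n)\setminus\{\langle n\rangle\}$. Put $m=a_{k-1}+1$, $n'=a_{k-1}+a_k$ and $\mu=\lfloor n'/m\rfloor-1$. Then the immediate lexicographic successor of $\langle a_1,\dots,a_k\rangle$ in $\mathcal{A}(n)$ is \[ \langle a_1,\dots,a_{k-2}\rangle \,\|\, \langle \underbrace{m,\dots,m}_{\mu}\rangle \,\|\, \langle n'-\mu m\rangle , \] where $\|$ denotes concatenation of sequences.
   Context: An ascending composition of a positive integer $n$ is a sequence of positive integers $\langle a_1,\dots,a_k\rangle$ with $a_1+\dots+a_k=n$ and $a_1\le\dots\le a_k$. $\mathcal{A}(n)$ is the set of all ascending compositions of $n$, ordered lexicographically. Every element of $\mathcal{A}(n)\setminus\{\langle n\rangle\}$ has $k\ge 2$ parts. -}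

module Defs where

open import Data.Nat using (ℕ; suc; _≤_; _<_; _+_; _*_; _∸_; _/_)
open import Data.List using (List; []; _∷_; replicate; _++_)
open import Data.Nat.ListAction using (sum)
open import Data.List.Relation.Unary.All using (All)
open import Data.List.Relation.Unary.Linked using (Linked)
open import Data.List.Relation.Binary.Lex.Core using (Lex-<)
open import Data.Product using (_×_)
open import Data.Empty using (⊥)
open import Relation.Binary.PropositionalEquality using (_≡_)
open import Relation.Nullary using (¬_)

IsAscComp : ℕ → List ℕ → Set
IsAscComp n as = All (λ a → 0 < a) as × Linked _≤_ as × sum as ≡ n

-- Strict lexicographic order on sequences of naturals
-- (a proper prefix is smaller).
_<lex_ : List ℕ → List ℕ → Set
_<lex_ = Lex-< _≡_ _<_

IsSuccessor : ℕ → List ℕ → List ℕ → Set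
IsSuccessor n a b =
  IsAscComp n b × (a <lex b) ×
  (∀ c → IsAscComp n c → a <lex c → c <lex b → ⊥)

-- The successor formula: for a = pre ++ ⟨x , y⟩ (x = a_{k-1}, y = a_k),
-- m = x + 1, n' = x + y, μ = ⌊n'/m⌋ − 1,
-- result = pre ++ ⟨m,…,m⟩ (μ times) ++ ⟨n' − μ m⟩.
succFormula : List ℕ → ℕ → ℕ → List ℕ
succFormula pre x y =
  pre ++ replicate μ m ++ (n' ∸ μ * m) ∷ []
  where
  m  = suc x
  n' = x + y
  μ  = (n' / m) ∸ 1

module Submission where

-- Write a = pre ++ ⟨x , y⟩ and put m = x + 1, n' = x + y,
-- μ = ⌊n'/m⌋ − 1 and L = n' − μm, so that the claimed successor is
-- pre ++ B with the block B = ⟨m,…,m,L⟩ (μ copies of m).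
--   * Division with remainder puts L in the window m ≤ L < 2m, and μm + L = n'.
--   * Minimality of the block: a list of parts ≥ m summing to μm + L cannot
--     be lexicographically below B, since B uses the smallest admissible part
--     m as long as possible and L < 2m cannot be split into two parts ≥ m.
--   * An ascending composition of n' above ⟨x , y⟩ has all parts ≥ m.
-- Together these show that B is the successor of ⟨x , y⟩ among the
-- compositions of n' (pair-successor).  Finally a common prefix creates no new
-- elements in between, and gluing B after pre keeps it ascending because all
-- parts of B exceed x (prefix-successor); the theorem combines the two.

open import Defs
open import Data.Nat
  using (ℕ; zero; suc; _<_; _≤_; _+_; _*_; _∸_; _/_; _%_; z≤n; z<s; NonZero)
open import Data.Nat.Properties
open import Data.Nat.DivMod using (m≡m%n+[m/n]*n; m%n<n; m/n*n≤m; m≥n⇒m/n>0)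
open import Data.List using (List; []; _∷_; _++_; replicate)
open import Data.Nat.ListAction using (sum)
open import Data.Nat.ListAction.Properties using (sum-++)
open import Data.List.Relation.Unary.All as All using (All; []; _∷_)
open import Data.List.Relation.Unary.All.Properties using (++⁺; ++⁻ˡ; ++⁻ʳ; replicate⁺)
open import Data.List.Relation.Unary.Linked using (Linked; []; [-]; _∷_; tail)
open import Data.List.Relation.Unary.Linked.Properties using (Linked⇒All)
open import Data.List.Relation.Binary.Lex.Core using (base; halt; this; next)
open import Data.Product using (_×_; _,_; proj₁; proj₂)
open import Data.Empty using (⊥; ⊥-elim)
open import Relation.Binary.PropositionalEquality
  using (_≡_; refl; sym; trans; cong; subst; module ≡-Reasoning)

Ascending : List ℕ → Set
Ascending = Linked _≤_

NoneBetween : ℕ → List ℕ → List ℕ → Set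
NoneBetween n a b = ∀ c → IsAscComp n c → a <lex c → c <lex b → ⊥

ascending-suffix : ∀ pre {ys} → Ascending (pre ++ ys) → Ascending ys
ascending-suffix []        ↑ = ↑
ascending-suffix (_ ∷ pre) ↑ = ascending-suffix pre (tail ↑)

cons-ascending : ∀ {p vs} → All (p ≤_) vs → Ascending vs → Ascending (p ∷ vs)
cons-ascending []        []  = [-]
cons-ascending (p≤v ∷ _) vs↑ = p≤v ∷ vs↑

replace-tail : ∀ pre {u us vs} → Ascending (pre ++ u ∷ us) →
               All (u ≤_) vs → Ascending vs → Ascending (pre ++ vs)
replace-tail []              _          _    vs↑ = vs↑
replace-tail (p ∷ [])        (p≤u ∷ _)  u≤vs vs↑ =
  cons-ascending (All.map (≤-trans p≤u) u≤vs) vs↑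
replace-tail (p ∷ p' ∷ pre) (p≤p' ∷ ↑) u≤vs vs↑ =
  p≤p' ∷ replace-tail (p' ∷ pre) ↑ u≤vs vs↑

prefix-lex : ∀ pre {u v} → u <lex v → (pre ++ u) <lex (pre ++ v)
prefix-lex []        u<v = u<v
prefix-lex (_ ∷ pre) u<v = next refl (prefix-lex pre u<v)

composition-tail : ∀ {p n c} → IsAscComp (p + n) (p ∷ c) → IsAscComp n c
composition-tail {p} (_ ∷ pos , ↑ , s) = pos , tail ↑ , +-cancelˡ-≡ p _ _ s

-- A common prefix creates no new elements strictly between two sequences:
-- anything between pre ++ u and pre ++ v must itself start with pre.
none-between-prefix : ∀ pre {u v} → NoneBetween (sum u) u v →
  NoneBetween (sum (pre ++ u)) (pre ++ u) (pre ++ v)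
none-between-prefix []        none c c∈𝒜 u<c c<v = none c c∈𝒜 u<c c<v
none-between-prefix (p ∷ pre) none (q ∷ c) _ (this p<q) (this q<p) = <-asym p<q q<p
none-between-prefix (p ∷ pre) none (q ∷ c) _ (this p<p) (next refl _) = <-irrefl refl p<p
none-between-prefix (p ∷ pre) none (q ∷ c) _ (next refl _) (this p<p) = <-irrefl refl p<p
none-between-prefix (p ∷ pre) none (q ∷ c) c∈𝒜 (next refl u<c) (next _ c<v) =
  none-between-prefix pre none c (composition-tail c∈𝒜) u<c c<v

-- An ascending composition of x + y lying above ⟨x , y⟩ has all parts > x:
-- equal first part x would force the second part to be y and the list to end.
parts-exceed-first : ∀ {x y c} → IsAscComp (sum (x ∷ y ∷ [])) c →
                     (x ∷ y ∷ []) <lex c → All (suc x ≤_) c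
parts-exceed-first (_ , ↑ , _) (this x<c₁) = Linked⇒All ≤-trans x<c₁ ↑
parts-exceed-first {x} (_ , _ , s) (next refl (this y<c₂)) =
  ⊥-elim (<-irrefl (sym (+-cancelˡ-≡ x _ _ s)) (+-mono-<-≤ y<c₂ z≤n))
parts-exceed-first {x} {y} {_ ∷ _ ∷ d ∷ cs} (_ ∷ _ ∷ 0<d ∷ _ , _ , s) (next refl (next refl halt)) =
  ⊥-elim (<-irrefl (sym (+-cancelˡ-≡ y _ _ (+-cancelˡ-≡ x _ _ s)))
                   (<-≤-trans 0<d (m≤m+n d (sum cs))))
parts-exceed-first _ (next refl (next refl (base ())))

block : ℕ → ℕ → ℕ → List ℕ
block k m L = replicate k m ++ L ∷ []

-- The range of admissible last parts: L can not be split into two parts ≥ m.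
Window : ℕ → ℕ → Set
Window m L = m ≤ L × L < m + m

-- A last part in a window is positive (even when m = 0 the window is empty).
window-positive : ∀ {m L} → Window m L → 0 < L
window-positive {L = suc _} _ = z<s
window-positive {zero} {zero} (_ , ())

block-sum : ∀ k m L → sum (block k m L) ≡ k * m + L
block-sum zero    m L = +-identityʳ L
block-sum (suc k) m L = trans (cong (m +_) (block-sum k m L)) (sym (+-assoc m (k * m) L))

block-lower-bound : ∀ k {m L} → m ≤ L → All (m ≤_) (block k m L)
block-lower-bound k m≤L = ++⁺ (replicate⁺ k ≤-refl) (m≤L ∷ [])

block-ascending : ∀ k {m L} → m ≤ L → Ascending (block k m L)
block-ascending zero    m≤L = [-]
block-ascending (suc k) m≤L =
  cons-ascending (block-lower-bound k m≤L) (block-ascending k m≤L)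

block-above : ∀ k {m L x ys} → x < m → m ≤ L → (x ∷ ys) <lex block k m L
block-above zero    x<m m≤L = this (<-≤-trans x<m m≤L)
block-above (suc k) x<m _   = this x<m

block-minimal : ∀ k {m L} → Window m L → ∀ c → All (m ≤_) c →
                sum c ≡ k * m + L → c <lex block k m L → ⊥
block-minimal zero    w [] _ s halt = <-irrefl s (window-positive w)
block-minimal zero    _ (c₁ ∷ []) _ s (this c₁<L) =
  <-irrefl (trans (sym (+-identityʳ c₁)) s) c₁<L
block-minimal zero    _ (c₁ ∷ []) _ _ (next _ (base ()))
block-minimal zero    (_ , L<2m) (c₁ ∷ d ∷ cs) (m≤c₁ ∷ m≤d ∷ _) s (this _) =
  <-irrefl (sym s) (<-≤-trans L<2m (+-mono-≤ m≤c₁ (≤-trans m≤d (m≤m+n d (sum cs)))))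
block-minimal (suc k) {m} {L} w [] _ s halt =
  <-irrefl s (<-≤-trans (window-positive w) (m≤n+m L (m + k * m)))
block-minimal (suc k) _ (c₁ ∷ _) (m≤c₁ ∷ _) _ (this c₁<m) =
  <-irrefl refl (<-≤-trans c₁<m m≤c₁)
block-minimal (suc k) {m} {L} w (_ ∷ c) (_ ∷ m≤c) s (next refl c<B) =
  block-minimal k w c m≤c (+-cancelˡ-≡ m _ _ (trans s (+-assoc m (k * m) L))) c<B

-- If n' = r + q·m with r < m and q ≥ 1, removing q − 1 copies of m from n'
-- leaves r + m, which lies in the window.
remainder-window : ∀ m n' q r → n' ≡ r + q * m → r < m → 0 < q →
                   Window m (n' ∸ (q ∸ 1) * m)
remainder-window m n' (suc μ) r n'≡ r<m _ =
  subst (Window m) (sym L≡r+m) (m≤n+m m r , +-monoˡ-< m r<m)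
  where
  open ≡-Reasoning
  L≡r+m : n' ∸ μ * m ≡ r + m
  L≡r+m = begin
    n' ∸ μ * m             ≡⟨ cong (_∸ μ * m) n'≡ ⟩
    r + (m + μ * m) ∸ μ * m ≡⟨ cong (_∸ μ * m) (sym (+-assoc r m (μ * m))) ⟩
    r + m + μ * m ∸ μ * m   ≡⟨ m+n∸n≡m (r + m) (μ * m) ⟩
    r + m                   ∎

division-window : ∀ m n' .{{_ : NonZero m}} → m ≤ n' →
  Window m (n' ∸ (n' / m ∸ 1) * m) × (n' / m ∸ 1) * m + (n' ∸ (n' / m ∸ 1) * m) ≡ n'
division-window m n' m≤n' =
  remainder-window m n' (n' / m) (n' % m) (m≡m%n+[m/n]*n n' m) (m%n<n n' m) (m≥n⇒m/n>0 m≤n')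
  , m+[n∸m]≡n (≤-trans (*-monoˡ-≤ m (m∸n≤m (n' / m) 1)) (m/n*n≤m n' m))

pair-successor : ∀ {x y} → 0 < x → x ≤ y →
  All (x <_) (succFormula [] x y) ×
  IsSuccessor (sum (x ∷ y ∷ [])) (x ∷ y ∷ []) (succFormula [] x y)
pair-successor {x} {y} 0<x x≤y =
  above , (All.map (<-≤-trans z<s) above , block-ascending μ m≤L , sum-block) ,
  block-above μ ≤-refl m≤L , none-between
  where
  m  = suc x
  n' = x + y
  μ  = n' / m ∸ 1
  L  = n' ∸ μ * m

  sum-pair : sum (x ∷ y ∷ []) ≡ n'
  sum-pair = cong (x +_) (+-identityʳ y)

  division : Window m L × μ * m + L ≡ n'
  division = division-window m n' (m<m+n x (<-≤-trans 0<x x≤y))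

  m≤L : m ≤ L
  m≤L = proj₁ (proj₁ division)

  above : All (x <_) (block μ m L)
  above = block-lower-bound μ m≤L

  sum-block : sum (block μ m L) ≡ sum (x ∷ y ∷ [])
  sum-block = trans (block-sum μ m L) (trans (proj₂ division) (sym sum-pair))

  none-between : NoneBetween (sum (x ∷ y ∷ [])) (x ∷ y ∷ []) (block μ m L)
  none-between c c∈𝒜@(_ , _ , sum-c) a<c c<B =
    block-minimal μ (proj₁ division) c (parts-exceed-first c∈𝒜 a<c)
      (trans sum-c (trans sum-pair (sym (proj₂ division)))) c<B

prefix-successor : ∀ pre {u us v} →
  All (0 <_) (pre ++ u ∷ us) → Ascending (pre ++ u ∷ us) → All (u ≤_) v →
  IsSuccessor (sum (u ∷ us)) (u ∷ us) v →
  IsSuccessor (sum (pre ++ u ∷ us)) (pre ++ u ∷ us) (pre ++ v)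
prefix-successor pre {u} {us} {v} pos ↑ u≤v ((v-pos , v↑ , v-sum) , u<v , none) =
  (++⁺ (++⁻ˡ pre pos) v-pos , replace-tail pre ↑ u≤v v↑ , total) ,
  prefix-lex pre u<v , none-between-prefix pre none
  where
  open ≡-Reasoning
  total : sum (pre ++ v) ≡ sum (pre ++ u ∷ us)
  total = begin
    sum (pre ++ v)           ≡⟨ sum-++ pre v ⟩
    sum pre + sum v          ≡⟨ cong (sum pre +_) v-sum ⟩
    sum pre + sum (u ∷ us)   ≡⟨ sym (sum-++ pre (u ∷ us)) ⟩
    sum (pre ++ u ∷ us)      ∎

theorem3p4 : (n : ℕ) → 0 < n → (pre : List ℕ) → (x y : ℕ) →
    IsAscComp n (pre ++ x ∷ y ∷ []) →
    IsSuccessor n (pre ++ x ∷ y ∷ []) (succFormula pre x y)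
theorem3p4 n _ pre x y (pos , ↑ , s)
  with 0<x ∷ _ ← ++⁻ʳ pre pos | x≤y ∷ _ ← ascending-suffix pre ↑
  with above , successor ← pair-successor 0<x x≤y =
  subst (λ k → IsSuccessor k _ _) s
    (prefix-successor pre pos ↑ (All.map <⇒≤ above) successor)
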